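{- Let $G=(V,E)$ be a finite, simple, connected graph with $|E|=m$, minimum degree $\delta$ and maximum degree $\Delta$. Then $$\sqrt{2}\pi\left(\frac{SO_1(G)+m\delta^2}{\Delta}\right)\leq SO_3(G)\leq\sqrt{2}\pi\left(\frac{SO_1(G)+m\Delta^2}{\delta}\right).$$
   Context: $d_v$ is the degree of $v$. $SO_1(G)=\frac{1}{2}\sum_{uv\in E(G)}|d_u^2-d_v^2|$ and $SO_3(G)=\sum_{uv\in E(G)}\sqrt{2}\,\frac{d_u^2+d_v^2}{d_u+d_v}\pi$. -}

module Defs where

open import Data.Nat as ℕ using (ℕ; zero; suc; _⊓_; _⊔_; ∣_-_∣)
open import Data.Fin using (Fin; toℕ) renaming (zero to fz; suc to fs)
open import Data.Bool using (Bool; true; false; if_then_else_; _∧_)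
open import Data.Integer using (+_)
open import Data.Rational as ℚ using (ℚ; 0ℚ; 1ℚ)
open import Relation.Binary.PropositionalEquality using (_≡_)
open import Relation.Nullary.Decidable using (⌊_⌋)

record SimpleGraph (n : ℕ) : Set where
  field
    adj   : Fin n → Fin n → Bool
    sym   : ∀ i j → adj i j ≡ adj j i
    irrefl : ∀ i → adj i i ≡ false

open SimpleGraph public

sumℕ : ∀ {n} → (Fin n → ℕ) → ℕ
sumℕ {zero}  f = 0
sumℕ {suc n} f = f fz ℕ.+ sumℕ (λ i → f (fs i))

sumℚ : ∀ {n} → (Fin n → ℚ) → ℚ
sumℚ {zero}  f = 0ℚ
sumℚ {suc n} f = f fz ℚ.+ sumℚ (λ i → f (fs i))

minF : ∀ {n} → (Fin (suc n) → ℕ) → ℕ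
minF {zero}  f = f fz
minF {suc n} f = f fz ⊓ minF (λ i → f (fs i))

maxF : ∀ {n} → (Fin (suc n) → ℕ) → ℕ
maxF {zero}  f = f fz
maxF {suc n} f = f fz ⊔ maxF (λ i → f (fs i))

deg : ∀ {n} → SimpleGraph n → Fin n → ℕ
deg G v = sumℕ (λ w → if adj G v w then 1 else 0)

-- each edge uv counted once: unordered pair {i,j} with toℕ i < toℕ j
isEdge : ∀ {n} → SimpleGraph n → Fin n → Fin n → Bool
isEdge G i j = adj G i j ∧ ⌊ toℕ i ℕ.<? toℕ j ⌋

edgeSum : ∀ {n} → SimpleGraph n → (Fin n → Fin n → ℚ) → ℚ
edgeSum G f = sumℚ (λ i → sumℚ (λ j → if isEdge G i j then f i j else 0ℚ))

numEdges : ∀ {n} → SimpleGraph n → ℕ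
numEdges G = sumℕ (λ i → sumℕ (λ j → if isEdge G i j then 1 else 0))

minDeg : ∀ {n} → SimpleGraph (suc n) → ℕ
minDeg G = minF (deg G)

maxDeg : ∀ {n} → SimpleGraph (suc n) → ℕ
maxDeg G = maxF (deg G)

data Reach {n} (G : SimpleGraph n) : Fin n → Fin n → Set where
  here : ∀ {i} → Reach G i i
  step : ∀ {i j k} → adj G i j ≡ true → Reach G j k → Reach G i k

Connected : ∀ {n} → SimpleGraph n → Set
Connected G = ∀ i j → Reach G i j

-- the natural number a viewed in ℚ, divided by b (total: value 0 when b = 0;
-- only ever used with b ≠ 0 under the theorem's hypotheses)
_÷ℕ_ : ℚ → ℕ → ℚ
p ÷ℕ zero  = 0ℚ
p ÷ℕ suc b = p ℚ.* ((+ 1) ℚ./ suc b)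

toℚ : ℕ → ℚ
toℚ a = (+ a) ℚ./ 1

SO₁ : ∀ {n} → SimpleGraph n → ℚ
SO₁ G = edgeSum G (λ u v → toℚ ∣ deg G u ℕ.^ 2 - deg G v ℕ.^ 2 ∣) ÷ℕ 2

-- SO_3(G) divided by the constant √2·π:
-- SO₃/(√2 π) = Σ_{uv∈E} (d_u^2 + d_v^2)/(d_u + d_v)
SO₃-over-√2π : ∀ {n} → SimpleGraph n → ℚ
SO₃-over-√2π G =
  edgeSum G (λ u v → toℚ (deg G u ℕ.^ 2 ℕ.+ deg G v ℕ.^ 2) ÷ℕ (deg G u ℕ.+ deg G v))

{-# OPTIONS --safe #-}
-- Fix an edge uv and write a = d_u, b = d_v. Since |a² − b²|/2 + min(a², b²) = (a² + b²)/2
-- and 2δ ≤ a + b ≤ 2Δ, δ² ≤ min(a², b²) ≤ Δ², the edge term (a² + b²)/(a + b) of SO₃/(√2π)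
-- lies between (|a² − b²|/2 + δ²)/Δ and (|a² − b²|/2 + Δ²)/δ; summing over the edges gives
-- both bounds. Connectivity (on at least two vertices) is needed only for δ ≥ 1.
module Submission where

open import Defs hiding (sym)
open import Data.Nat using (ℕ; suc; _≤_; _^_; _*_)
open import Data.Rational using (_+_) renaming (_≤_ to _≤ℚ_)
open import Data.Product using (_×_; _,_; ∃)

open import Algebra.Bundles using (CommutativeMonoid)
open import Data.Bool using (true; false; if_then_else_)
open import Data.Fin using (Fin) renaming (zero to fz; suc to fs)
open import Data.Integer as ℤ using (+_)
import Data.Integer.Properties as ℤP
open import Data.Nat as ℕ using (zero; _⊓_; ∣_-_∣; s≤s; z≤n)
import Data.Nat.Coprimality as Coprime
import Data.Nat.Properties as ℕP
open import Data.Rational as ℚ using (ℚ; mkℚ; 0ℚ; 1ℚ; NonNegative; *≤*) renaming (_*_ to _·_)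
import Data.Rational.Properties as ℚP
open import Data.Sum using (inj₁; inj₂)
open import Relation.Binary.PropositionalEquality
open import Relation.Nullary using (¬_; contradiction)

open import Algebra.Properties.CommutativeSemigroup
  (CommutativeMonoid.commutativeSemigroup ℚP.+-0-commutativeMonoid)
  using () renaming (interchange to +-interchange)

1/suc : ℕ → ℚ
1/suc k = + 1 ℚ./ suc k

toℚ-mkℚ : ∀ a → toℚ a ≡ mkℚ (+ a) 0 (Coprime.sym (Coprime.1-coprimeTo a))
toℚ-mkℚ a = ℚP.normalize-coprime (Coprime.sym (Coprime.1-coprimeTo a))

1/suc-mkℚ : ∀ k → 1/suc k ≡ mkℚ (+ 1) k (Coprime.1-coprimeTo (suc k))
1/suc-mkℚ k = ℚP.normalize-coprime (Coprime.1-coprimeTo (suc k))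

toℚ-+ : ∀ a b → toℚ (a ℕ.+ b) ≡ toℚ a + toℚ b
toℚ-+ a b rewrite toℚ-mkℚ a | toℚ-mkℚ b = ℚP./-cong
  (trans (ℤP.pos-+ a b) (sym (cong₂ ℤ._+_ (ℤP.*-identityʳ (+ a)) (ℤP.*-identityʳ (+ b))))) refl

toℚ-* : ∀ a b → toℚ (a * b) ≡ toℚ a · toℚ b
toℚ-* a b rewrite toℚ-mkℚ a | toℚ-mkℚ b = ℚP./-cong (ℤP.pos-* a b) refl

toℚ-mono-≤ : ∀ {a b} → a ≤ b → toℚ a ≤ℚ toℚ b
toℚ-mono-≤ {a} {b} a≤b rewrite toℚ-mkℚ a | toℚ-mkℚ b =
  *≤* (subst₂ ℤ._≤_ (sym (ℤP.*-identityʳ (+ a))) (sym (ℤP.*-identityʳ (+ b))) (ℤ.+≤+ a≤b))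

toℚ-suc·1/suc : ∀ k → toℚ (suc k) · 1/suc k ≡ 1ℚ
toℚ-suc·1/suc k = begin
  toℚ (suc k) · 1/suc k     ≡⟨ cong₂ _·_ (toℚ-mkℚ (suc k)) (1/suc-mkℚ k) ⟩
  [1+k] · ℚ.1/ [1+k]        ≡⟨ ℚP.*-inverseʳ [1+k] ⟩
  1ℚ                        ∎
  where
  open ≡-Reasoning
  [1+k] : ℚ
  [1+k] = mkℚ (+ suc k) 0 (Coprime.sym (Coprime.1-coprimeTo (suc k)))

-- suc k * suc l is definitionally suc (l + k * suc l), so both sides compute to the same rational.
1/suc-* : ∀ k l → 1/suc k · 1/suc l ≡ 1/suc (l ℕ.+ k * suc l)
1/suc-* k l = cong₂ _·_ (1/suc-mkℚ k) (1/suc-mkℚ l)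

1/suc-antimono-≤ : ∀ {k l} → k ≤ l → 1/suc l ≤ℚ 1/suc k
1/suc-antimono-≤ {k} {l} k≤l rewrite 1/suc-mkℚ k | 1/suc-mkℚ l =
  *≤* (subst₂ ℤ._≤_ (sym (ℤP.*-identityˡ _)) (sym (ℤP.*-identityˡ _)) (ℤ.+≤+ (s≤s k≤l)))

1/suc-nonNeg : ∀ k → NonNegative (1/suc k)
1/suc-nonNeg k = ℚP.normalize-nonNeg 1 (suc k)

0÷ℕ : ∀ k → 0ℚ ÷ℕ k ≡ 0ℚ
0÷ℕ zero    = refl
0÷ℕ (suc k) = ℚP.*-zeroˡ (1/suc k)

÷ℕ-distrib-+ : ∀ k p q → (p + q) ÷ℕ k ≡ p ÷ℕ k + q ÷ℕ k
÷ℕ-distrib-+ zero    p q = refl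
÷ℕ-distrib-+ (suc k) p q = ℚP.*-distribʳ-+ (1/suc k) p q

÷ℕ-monoˡ-≤ : ∀ k {p q} → p ≤ℚ q → p ÷ℕ k ≤ℚ q ÷ℕ k
÷ℕ-monoˡ-≤ zero    p≤q = ℚP.≤-refl
÷ℕ-monoˡ-≤ (suc k) p≤q = ℚP.*-monoʳ-≤-nonNeg (1/suc k) {{1/suc-nonNeg k}} p≤q

÷ℕ-antimonoʳ-≤ : ∀ p .{{_ : NonNegative p}} {m n} → 1 ≤ m → m ≤ n → p ÷ℕ n ≤ℚ p ÷ℕ m
÷ℕ-antimonoʳ-≤ p {suc k} {suc l} _ (s≤s k≤l) = ℚP.*-monoˡ-≤-nonNeg p (1/suc-antimono-≤ k≤l)

÷ℕ-÷ℕ : ∀ p m n → (p ÷ℕ m) ÷ℕ n ≡ p ÷ℕ (m * n)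
÷ℕ-÷ℕ p zero    n       = 0÷ℕ n
÷ℕ-÷ℕ p (suc k) zero    rewrite ℕP.*-zeroʳ k = refl
÷ℕ-÷ℕ p (suc k) (suc l) = trans (ℚP.*-assoc p (1/suc k) (1/suc l)) (cong (p ·_) (1/suc-* k l))

·toℚ-÷ℕ-cancel : ∀ p k → (p · toℚ (suc k)) ÷ℕ suc k ≡ p
·toℚ-÷ℕ-cancel p k = begin
  p · toℚ (suc k) · 1/suc k     ≡⟨ ℚP.*-assoc p _ _ ⟩
  p · (toℚ (suc k) · 1/suc k)   ≡⟨ cong (p ·_) (toℚ-suc·1/suc k) ⟩
  p · 1ℚ                        ≡⟨ ℚP.*-identityʳ p ⟩
  p                             ∎
  where open ≡-Reasoning

n∸m+m*2≡m+n : ∀ {m n} → m ≤ n → n ℕ.∸ m ℕ.+ m * 2 ≡ m ℕ.+ n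
n∸m+m*2≡m+n {m} {n} m≤n = begin
  n ℕ.∸ m ℕ.+ m * 2           ≡⟨ cong (n ℕ.∸ m ℕ.+_) (trans (ℕP.*-comm m 2) (cong (m ℕ.+_) (ℕP.+-identityʳ m))) ⟩
  n ℕ.∸ m ℕ.+ (m ℕ.+ m)       ≡⟨ ℕP.+-assoc (n ℕ.∸ m) m m ⟨
  n ℕ.∸ m ℕ.+ m ℕ.+ m         ≡⟨ cong (ℕ._+ m) (ℕP.m∸n+n≡m m≤n) ⟩
  n ℕ.+ m                     ≡⟨ ℕP.+-comm n m ⟩
  m ℕ.+ n                     ∎
  where open ≡-Reasoning

∣m-n∣+[m⊓n]*2≡m+n : ∀ m n → ∣ m - n ∣ ℕ.+ m ⊓ n * 2 ≡ m ℕ.+ n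
∣m-n∣+[m⊓n]*2≡m+n m n with ℕP.≤-total m n
... | inj₁ m≤n rewrite ℕP.m≤n⇒∣m-n∣≡n∸m m≤n | ℕP.m≤n⇒m⊓n≡m m≤n = n∸m+m*2≡m+n m≤n
... | inj₂ n≤m rewrite ℕP.m≤n⇒∣n-m∣≡n∸m n≤m | ℕP.m≥n⇒m⊓n≡n n≤m | ℕP.+-comm m n = n∸m+m*2≡m+n n≤m

∣m-n∣/2+m⊓n≡[m+n]/2 : ∀ m n → toℚ ∣ m - n ∣ ÷ℕ 2 + toℚ (m ⊓ n) ≡ toℚ (m ℕ.+ n) ÷ℕ 2
∣m-n∣/2+m⊓n≡[m+n]/2 m n = begin
  toℚ ∣ m - n ∣ ÷ℕ 2 + toℚ (m ⊓ n)                         ≡⟨ cong (_+_ (toℚ ∣ m - n ∣ ÷ℕ 2)) (·toℚ-÷ℕ-cancel (toℚ (m ⊓ n)) 1) ⟨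
  toℚ ∣ m - n ∣ ÷ℕ 2 + (toℚ (m ⊓ n) · toℚ 2) ÷ℕ 2          ≡⟨ ÷ℕ-distrib-+ 2 (toℚ ∣ m - n ∣) (toℚ (m ⊓ n) · toℚ 2) ⟨
  (toℚ ∣ m - n ∣ + toℚ (m ⊓ n) · toℚ 2) ÷ℕ 2               ≡⟨ cong (λ q → (toℚ ∣ m - n ∣ + q) ÷ℕ 2) (toℚ-* (m ⊓ n) 2) ⟨
  (toℚ ∣ m - n ∣ + toℚ (m ⊓ n * 2)) ÷ℕ 2                   ≡⟨ cong (_÷ℕ 2) (toℚ-+ ∣ m - n ∣ (m ⊓ n * 2)) ⟨
  toℚ (∣ m - n ∣ ℕ.+ m ⊓ n * 2) ÷ℕ 2                        ≡⟨ cong (λ a → toℚ a ÷ℕ 2) (∣m-n∣+[m⊓n]*2≡m+n m n) ⟩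
  toℚ (m ℕ.+ n) ÷ℕ 2                                        ∎
  where open ≡-Reasoning

toℚ-nonNeg : ∀ a → NonNegative (toℚ a)
toℚ-nonNeg a = ℚP.normalize-nonNeg a 1

so₃-term-lower : ∀ {a b δ Δ} → 1 ≤ a ℕ.+ b → δ ≤ a → δ ≤ b → a ≤ Δ → b ≤ Δ →
  (toℚ ∣ a ^ 2 - b ^ 2 ∣ ÷ℕ 2 + toℚ (δ ^ 2)) ÷ℕ Δ ≤ℚ toℚ (a ^ 2 ℕ.+ b ^ 2) ÷ℕ (a ℕ.+ b)
so₃-term-lower {a} {b} {δ} {Δ} 1≤a+b δ≤a δ≤b a≤Δ b≤Δ = begin
  (toℚ ∣ A - B ∣ ÷ℕ 2 + toℚ (δ ^ 2)) ÷ℕ Δ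
    ≤⟨ ÷ℕ-monoˡ-≤ Δ (ℚP.+-monoʳ-≤ (toℚ ∣ A - B ∣ ÷ℕ 2) (toℚ-mono-≤ δ²≤A⊓B)) ⟩
  (toℚ ∣ A - B ∣ ÷ℕ 2 + toℚ (A ⊓ B)) ÷ℕ Δ
    ≡⟨ cong (_÷ℕ Δ) (∣m-n∣/2+m⊓n≡[m+n]/2 A B) ⟩
  (toℚ (A ℕ.+ B) ÷ℕ 2) ÷ℕ Δ
    ≡⟨ ÷ℕ-÷ℕ (toℚ (A ℕ.+ B)) 2 Δ ⟩
  toℚ (A ℕ.+ B) ÷ℕ (2 * Δ)
    ≤⟨ ÷ℕ-antimonoʳ-≤ (toℚ (A ℕ.+ B)) {{toℚ-nonNeg (A ℕ.+ B)}} 1≤a+b a+b≤2Δ ⟩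
  toℚ (A ℕ.+ B) ÷ℕ (a ℕ.+ b) ∎
  where
  open ℚP.≤-Reasoning
  A B : ℕ
  A = a ^ 2
  B = b ^ 2
  δ²≤A⊓B : δ ^ 2 ≤ A ⊓ B
  δ²≤A⊓B = ℕP.⊓-glb (ℕP.^-monoˡ-≤ 2 δ≤a) (ℕP.^-monoˡ-≤ 2 δ≤b)
  a+b≤2Δ : a ℕ.+ b ≤ 2 * Δ
  a+b≤2Δ = ℕP.+-mono-≤ a≤Δ (ℕP.≤-trans b≤Δ (ℕP.m≤m+n Δ 0))

so₃-term-upper : ∀ {a b δ Δ} → 1 ≤ δ → δ ≤ a → δ ≤ b → a ≤ Δ →
  toℚ (a ^ 2 ℕ.+ b ^ 2) ÷ℕ (a ℕ.+ b) ≤ℚ (toℚ ∣ a ^ 2 - b ^ 2 ∣ ÷ℕ 2 + toℚ (Δ ^ 2)) ÷ℕ δ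
so₃-term-upper {a} {b} {δ} {Δ} 1≤δ δ≤a δ≤b a≤Δ = begin
  toℚ (A ℕ.+ B) ÷ℕ (a ℕ.+ b)
    ≤⟨ ÷ℕ-antimonoʳ-≤ (toℚ (A ℕ.+ B)) {{toℚ-nonNeg (A ℕ.+ B)}} (ℕP.≤-trans 1≤δ (ℕP.m≤m+n δ _)) 2δ≤a+b ⟩
  toℚ (A ℕ.+ B) ÷ℕ (2 * δ)
    ≡⟨ ÷ℕ-÷ℕ (toℚ (A ℕ.+ B)) 2 δ ⟨
  (toℚ (A ℕ.+ B) ÷ℕ 2) ÷ℕ δ
    ≡⟨ cong (_÷ℕ δ) (∣m-n∣/2+m⊓n≡[m+n]/2 A B) ⟨
  (toℚ ∣ A - B ∣ ÷ℕ 2 + toℚ (A ⊓ B)) ÷ℕ δ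
    ≤⟨ ÷ℕ-monoˡ-≤ δ (ℚP.+-monoʳ-≤ (toℚ ∣ A - B ∣ ÷ℕ 2) (toℚ-mono-≤ A⊓B≤Δ²)) ⟩
  (toℚ ∣ A - B ∣ ÷ℕ 2 + toℚ (Δ ^ 2)) ÷ℕ δ ∎
  where
  open ℚP.≤-Reasoning
  A B : ℕ
  A = a ^ 2
  B = b ^ 2
  A⊓B≤Δ² : A ⊓ B ≤ Δ ^ 2
  A⊓B≤Δ² = ℕP.≤-trans (ℕP.m⊓n≤m A B) (ℕP.^-monoˡ-≤ 2 a≤Δ)
  2δ≤a+b : 2 * δ ≤ a ℕ.+ b
  2δ≤a+b = ℕP.+-mono-≤ δ≤a (ℕP.≤-trans (ℕP.≤-reflexive (ℕP.+-identityʳ δ)) δ≤b)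

sumℚ-cong : ∀ {n} {f g : Fin n → ℚ} → (∀ i → f i ≡ g i) → sumℚ f ≡ sumℚ g
sumℚ-cong {zero}  f≗g = refl
sumℚ-cong {suc n} f≗g = cong₂ _+_ (f≗g fz) (sumℚ-cong (λ i → f≗g (fs i)))

sumℚ-mono-≤ : ∀ {n} {f g : Fin n → ℚ} → (∀ i → f i ≤ℚ g i) → sumℚ f ≤ℚ sumℚ g
sumℚ-mono-≤ {zero}  f≤g = ℚP.≤-refl
sumℚ-mono-≤ {suc n} f≤g = ℚP.+-mono-≤ (f≤g fz) (sumℚ-mono-≤ (λ i → f≤g (fs i)))

sumℚ-distrib-+ : ∀ {n} (f g : Fin n → ℚ) → sumℚ (λ i → f i + g i) ≡ sumℚ f + sumℚ g
sumℚ-distrib-+ {zero}  f g = refl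
sumℚ-distrib-+ {suc n} f g = begin
  (f fz + g fz) + sumℚ (λ i → f (fs i) + g (fs i))
    ≡⟨ cong (_+_ (f fz + g fz)) (sumℚ-distrib-+ (λ i → f (fs i)) (λ i → g (fs i))) ⟩
  (f fz + g fz) + (sumℚ (λ i → f (fs i)) + sumℚ (λ i → g (fs i)))
    ≡⟨ +-interchange (f fz) (g fz) _ _ ⟩
  (f fz + sumℚ (λ i → f (fs i))) + (g fz + sumℚ (λ i → g (fs i))) ∎
  where open ≡-Reasoning

sumℚ-÷ℕ : ∀ {n} k (f : Fin n → ℚ) → sumℚ f ÷ℕ k ≡ sumℚ (λ i → f i ÷ℕ k)
sumℚ-÷ℕ {zero}  k f = 0÷ℕ k
sumℚ-÷ℕ {suc n} k f =
  trans (÷ℕ-distrib-+ k (f fz) _) (cong (_+_ (f fz ÷ℕ k)) (sumℚ-÷ℕ k (λ i → f (fs i))))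

toℚ-sumℕ : ∀ {n} (f : Fin n → ℕ) → toℚ (sumℕ f) ≡ sumℚ (λ i → toℚ (f i))
toℚ-sumℕ {zero}  f = refl
toℚ-sumℕ {suc n} f = trans (toℚ-+ (f fz) _) (cong (_+_ (toℚ (f fz))) (toℚ-sumℕ (λ i → f (fs i))))

sumℕ-*-distribʳ : ∀ {n} (f : Fin n → ℕ) c → sumℕ f * c ≡ sumℕ (λ i → f i * c)
sumℕ-*-distribʳ {zero}  f c = refl
sumℕ-*-distribʳ {suc n} f c =
  trans (ℕP.*-distribʳ-+ c (f fz) _) (cong (f fz * c ℕ.+_) (sumℕ-*-distribʳ (λ i → f (fs i)) c))

module _ {n} (G : SimpleGraph n) where

  onEdges : (Fin n → Fin n → ℚ) → Fin n → Fin n → ℚ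
  onEdges F i j = if isEdge G i j then F i j else 0ℚ

  edgeSum-÷ℕ : ∀ k F → edgeSum G F ÷ℕ k ≡ edgeSum G (λ u v → F u v ÷ℕ k)
  edgeSum-÷ℕ k F = trans (sumℚ-÷ℕ k (λ i → sumℚ (onEdges F i))) (sumℚ-cong λ i →
    trans (sumℚ-÷ℕ k (onEdges F i)) (sumℚ-cong λ j → if-÷ℕ (isEdge G i j)))
    where
    if-÷ℕ : ∀ {x} b → (if b then x else 0ℚ) ÷ℕ k ≡ (if b then x ÷ℕ k else 0ℚ)
    if-÷ℕ true  = refl
    if-÷ℕ false = 0÷ℕ k

  edgeSum-distrib-+ : ∀ F H → edgeSum G (λ u v → F u v + H u v) ≡ edgeSum G F + edgeSum G H
  edgeSum-distrib-+ F H = trans (sumℚ-cong λ i →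
      trans (sumℚ-cong λ j → if-+ (isEdge G i j)) (sumℚ-distrib-+ (onEdges F i) (onEdges H i)))
    (sumℚ-distrib-+ (λ i → sumℚ (onEdges F i)) (λ i → sumℚ (onEdges H i)))
    where
    if-+ : ∀ {x y} b → (if b then x + y else 0ℚ) ≡ (if b then x else 0ℚ) + (if b then y else 0ℚ)
    if-+ true  = refl
    if-+ false = refl

  toℚ-numEdges-* : ∀ c → toℚ (numEdges G * c) ≡ edgeSum G (λ _ _ → toℚ c)
  toℚ-numEdges-* c =
    trans (cong toℚ (sumℕ-*-distribʳ edgesFrom c)) (trans (toℚ-sumℕ (λ i → edgesFrom i * c)) (sumℚ-cong λ i →
    trans (cong toℚ (sumℕ-*-distribʳ (edgeIndicator i) c)) (trans (toℚ-sumℕ (λ j → edgeIndicator i j * c))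
      (sumℚ-cong λ j → if-* (isEdge G i j)))))
    where
    edgeIndicator : Fin n → Fin n → ℕ
    edgeIndicator i j = if isEdge G i j then 1 else 0
    edgesFrom : Fin n → ℕ
    edgesFrom i = sumℕ (edgeIndicator i)
    if-* : ∀ b → toℚ ((if b then 1 else 0) * c) ≡ (if b then toℚ c else 0ℚ)
    if-* true  = cong toℚ (ℕP.+-identityʳ c)
    if-* false = refl

  edgeSum-mono-≤ : ∀ {F H} → (∀ u v → F u v ≤ℚ H u v) → edgeSum G F ≤ℚ edgeSum G H
  edgeSum-mono-≤ {F} {H} F≤H = sumℚ-mono-≤ λ i → sumℚ-mono-≤ λ j → if-≤ (isEdge G i j)
    where
    if-≤ : ∀ {i j} b → (if b then F i j else 0ℚ) ≤ℚ (if b then H i j else 0ℚ)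
    if-≤ true  = F≤H _ _
    if-≤ false = ℚP.≤-refl

  SO₁+m·c÷ℕ≡edgeSum : ∀ c k → (SO₁ G + toℚ (numEdges G * c)) ÷ℕ k ≡
    edgeSum G (λ u v → (toℚ ∣ deg G u ^ 2 - deg G v ^ 2 ∣ ÷ℕ 2 + toℚ c) ÷ℕ k)
  SO₁+m·c÷ℕ≡edgeSum c k = begin
    (SO₁ G + toℚ (numEdges G * c)) ÷ℕ k
      ≡⟨ cong (_÷ℕ k) (cong₂ _+_ (edgeSum-÷ℕ 2 sqDiff) (toℚ-numEdges-* c)) ⟩
    (edgeSum G (λ u v → sqDiff u v ÷ℕ 2) + edgeSum G (λ _ _ → toℚ c)) ÷ℕ k
      ≡⟨ cong (_÷ℕ k) (edgeSum-distrib-+ (λ u v → sqDiff u v ÷ℕ 2) (λ _ _ → toℚ c)) ⟨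
    edgeSum G (λ u v → sqDiff u v ÷ℕ 2 + toℚ c) ÷ℕ k
      ≡⟨ edgeSum-÷ℕ k _ ⟩
    edgeSum G (λ u v → (sqDiff u v ÷ℕ 2 + toℚ c) ÷ℕ k) ∎
    where
    open ≡-Reasoning
    sqDiff : Fin n → Fin n → ℚ
    sqDiff u v = toℚ ∣ deg G u ^ 2 - deg G v ^ 2 ∣

term≤sumℕ : ∀ {n} (f : Fin n → ℕ) i → f i ≤ sumℕ f
term≤sumℕ f fz     = ℕP.m≤m+n (f fz) _
term≤sumℕ f (fs i) = ℕP.≤-trans (term≤sumℕ (λ j → f (fs j)) i) (ℕP.m≤n+m _ (f fz))

minF≤ : ∀ {n} (f : Fin (suc n) → ℕ) i → minF f ≤ f i
minF≤ {zero}  f fz     = ℕP.≤-refl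
minF≤ {suc n} f fz     = ℕP.m⊓n≤m _ _
minF≤ {suc n} f (fs i) = ℕP.≤-trans (ℕP.m⊓n≤n (f fz) _) (minF≤ (λ j → f (fs j)) i)

≤maxF : ∀ {n} (f : Fin (suc n) → ℕ) i → f i ≤ maxF f
≤maxF {zero}  f fz     = ℕP.≤-refl
≤maxF {suc n} f fz     = ℕP.m≤m⊔n _ _
≤maxF {suc n} f (fs i) = ℕP.≤-trans (≤maxF (λ j → f (fs j)) i) (ℕP.m≤n⊔m (f fz) _)

minF-glb : ∀ {n} (f : Fin (suc n) → ℕ) {k} → (∀ i → k ≤ f i) → k ≤ minF f
minF-glb {zero}  f k≤f = k≤f fz
minF-glb {suc n} f k≤f = ℕP.⊓-glb (k≤f fz) (minF-glb (λ j → f (fs j)) (λ j → k≤f (fs j)))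

adj⇒1≤deg : ∀ {n} (G : SimpleGraph n) {u v} → adj G u v ≡ true → 1 ≤ deg G u
adj⇒1≤deg G {u} {v} uv = ℕP.≤-trans (ℕP.≤-reflexive (cong (λ b → if b then 1 else 0) (sym uv)))
  (term≤sumℕ (λ w → if adj G u w then 1 else 0) v)

reach⇒neighbour : ∀ {n} {G : SimpleGraph n} {i j} → Reach G i j → ¬ i ≡ j → ∃ λ k → adj G i k ≡ true
reach⇒neighbour here         i≢i = contradiction refl i≢i
reach⇒neighbour (step ij _) _   = _ , ij

connected⇒1≤deg : ∀ {n} (G : SimpleGraph (suc n)) → 1 ≤ n → Connected G → ∀ i → 1 ≤ deg G i
connected⇒1≤deg G (s≤s z≤n) conn fz with reach⇒neighbour (conn fz (fs fz)) (λ ())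
... | _ , ik = adj⇒1≤deg G ik
connected⇒1≤deg G (s≤s z≤n) conn (fs i) with reach⇒neighbour (conn (fs i) fz) (λ ())
... | _ , ik = adj⇒1≤deg G ik

proposition4p3 : ∀ {n : ℕ} (G : SimpleGraph (suc n)) → 1 ≤ n → Connected G →
    ((SO₁ G + toℚ (numEdges G * (minDeg G ^ 2))) ÷ℕ maxDeg G) ≤ℚ SO₃-over-√2π G
    × SO₃-over-√2π G ≤ℚ ((SO₁ G + toℚ (numEdges G * (maxDeg G ^ 2))) ÷ℕ minDeg G)
proposition4p3 {n} G 1≤n conn = lower , upper
  where
  open ℚP.≤-Reasoning
  d : Fin (suc n) → ℕ
  d = deg G
  1≤d : ∀ u → 1 ≤ d u
  1≤d = connected⇒1≤deg G 1≤n conn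
  lower : ((SO₁ G + toℚ (numEdges G * (minDeg G ^ 2))) ÷ℕ maxDeg G) ≤ℚ SO₃-over-√2π G
  lower = begin
    (SO₁ G + toℚ (numEdges G * (minDeg G ^ 2))) ÷ℕ maxDeg G
      ≡⟨ SO₁+m·c÷ℕ≡edgeSum G (minDeg G ^ 2) (maxDeg G) ⟩
    edgeSum G (λ u v → (toℚ ∣ d u ^ 2 - d v ^ 2 ∣ ÷ℕ 2 + toℚ (minDeg G ^ 2)) ÷ℕ maxDeg G)
      ≤⟨ edgeSum-mono-≤ G (λ u v → so₃-term-lower (ℕP.≤-trans (1≤d u) (ℕP.m≤m+n (d u) (d v)))
           (minF≤ d u) (minF≤ d v) (≤maxF d u) (≤maxF d v)) ⟩
    SO₃-over-√2π G ∎
  upper : SO₃-over-√2π G ≤ℚ ((SO₁ G + toℚ (numEdges G * (maxDeg G ^ 2))) ÷ℕ minDeg G)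
  upper = begin
    SO₃-over-√2π G
      ≤⟨ edgeSum-mono-≤ G (λ u v → so₃-term-upper (minF-glb d 1≤d)
           (minF≤ d u) (minF≤ d v) (≤maxF d u)) ⟩
    edgeSum G (λ u v → (toℚ ∣ d u ^ 2 - d v ^ 2 ∣ ÷ℕ 2 + toℚ (maxDeg G ^ 2)) ÷ℕ minDeg G)
      ≡⟨ SO₁+m·c÷ℕ≡edgeSum G (maxDeg G ^ 2) (minDeg G) ⟨
    (SO₁ G + toℚ (numEdges G * (maxDeg G ^ 2))) ÷ℕ minDeg G ∎
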